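{- Let $T$ be a circle-tree which is determined by the sequence of circles $(C(i):i<k)$, and let $C\subseteq T$ be a set of vertices inducing a circle in $T$. Then there is $j<k$ such that $C=C(j)$.
   Context: All graphs are finite simple graphs; subgraphs are induced subgraphs. A circle is a finite connected graph in which every vertex has degree exactly $2$. For disjoint graphs $G,H$ with $\Delta(G),\Delta(H)\le3$ and vertices $x\in G$, $y\in H$ of degree $2$ in their respective graphs, $G+_{x,y}H$ is the disjoint union of $G$ and $H$ with the single extra edge $\{x,y\}$. A finite graph $T$ is a circle-tree determined by circles $(C(i):i<k)$ if $T(0)=C(0)$, for each $0<i<k$ the circle $C(i)$ is disjoint from $T(i-1)$ and $T(i)=T(i-1)+_{x,y}C(i)$ for some $x\in T(i-1)$ of degree $2$ in $T(i-1)$ and $y\in C(i)$, and $T=T(k-1)$. -}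

module Defs where

open import Data.Nat using (ℕ; zero; suc; _≤_; _≡ᵇ_)
open import Data.Bool using (Bool; true; false; _∧_; _∨_)
open import Data.List using (List; []; _∷_; length; filterᵇ; _++_)
open import Data.Bool.ListAction using (any)
open import Data.List.Membership.Propositional using (_∈_)
open import Data.List.Relation.Unary.Unique.Propositional using (Unique)
open import Data.Product using (_×_; Σ; ∃; _,_; proj₁; proj₂)
open import Data.Empty using (⊥)
open import Relation.Binary.PropositionalEquality using (_≡_)

record Graph : Set where
  constructor mkGraph
  field
    verts : List ℕ
    adj   : ℕ → ℕ → Bool
open Graph public

IsSimpleGraph : Graph → Set
IsSimpleGraph G =
  Unique (verts G) ×
  (∀ x y → adj G x y ≡ adj G y x) ×
  (∀ x → adj G x x ≡ false) ×
  (∀ x y → adj G x y ≡ true → x ∈ verts G × y ∈ verts G)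

deg : Graph → ℕ → ℕ
deg G x = length (filterᵇ (adj G x) (verts G))

data Reach (G : Graph) : ℕ → ℕ → Set where
  here : ∀ {x} → x ∈ verts G → Reach G x x
  step : ∀ {x z y} → x ∈ verts G → adj G x z ≡ true → Reach G z y → Reach G x y

Connected : Graph → Set
Connected G = (Σ ℕ λ v → v ∈ verts G) ×
              (∀ x y → x ∈ verts G → y ∈ verts G → Reach G x y)

IsCircle : Graph → Set
IsCircle G = IsSimpleGraph G × Connected G × (∀ x → x ∈ verts G → deg G x ≡ 2)

MaxDeg≤3 : Graph → Set
MaxDeg≤3 G = ∀ x → x ∈ verts G → deg G x ≤ 3

Disjoint : Graph → Graph → Set
Disjoint G H = ∀ v → v ∈ verts G → v ∈ verts H → ⊥

plus : Graph → Graph → ℕ → ℕ → Graph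
plus G H x y = mkGraph (verts G ++ verts H)
  (λ u v → adj G u v ∨ adj H u v ∨ ((u ≡ᵇ x) ∧ (v ≡ᵇ y)) ∨ ((u ≡ᵇ y) ∧ (v ≡ᵇ x)))

PlusOK : Graph → Graph → ℕ → ℕ → Set
PlusOK G H x y =
  IsSimpleGraph G × IsSimpleGraph H × Disjoint G H ×
  MaxDeg≤3 G × MaxDeg≤3 H ×
  x ∈ verts G × deg G x ≡ 2 × y ∈ verts H × deg H y ≡ 2

-- T(i) built from circles C and attachment points att i = (x_i , y_i) (used for i > 0)
ctStage : (ℕ → Graph) → (ℕ → ℕ × ℕ) → ℕ → Graph
ctStage C att zero    = C zero
ctStage C att (suc i) = plus (ctStage C att i) (C (suc i)) (proj₁ (att (suc i))) (proj₂ (att (suc i)))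

ValidCT : ℕ → (ℕ → Graph) → (ℕ → ℕ × ℕ) → Set
ValidCT m C att =
  (∀ i → i ≤ m → IsCircle (C i)) ×
  (∀ i → suc i ≤ m →
     PlusOK (ctStage C att i) (C (suc i)) (proj₁ (att (suc i))) (proj₂ (att (suc i))))

GraphEq : Graph → Graph → Set
GraphEq G H = verts G ≡ verts H × (∀ u v → adj G u v ≡ adj H u v)

IsCircleTreeBy : Graph → (k : ℕ) → (ℕ → Graph) → Set
IsCircleTreeBy T zero    C = ⊥
IsCircleTreeBy T (suc m) C =
  Σ (ℕ → ℕ × ℕ) λ att → ValidCT m C att × GraphEq T (ctStage C att m)

_∈ᵇ_ : ℕ → List ℕ → Bool
x ∈ᵇ xs = any (x ≡ᵇ_) xs

induced : Graph → List ℕ → Graph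
induced G S = mkGraph S (λ u v → adj G u v ∧ (u ∈ᵇ S) ∧ (v ∈ᵇ S))

SameSet : List ℕ → List ℕ → Set
SameSet A B = ∀ v → (v ∈ A → v ∈ B) × (v ∈ B → v ∈ A)

-- A circle S in G +_{x,y} H cannot meet both G and H: a walk in S from the G-side to the
-- H-side must cross the only edge between them, so x, y ∈ S, and then in the subgraph induced
-- on S ∩ G every vertex has degree 2 except x, which has degree 1, contradicting the handshake
-- lemma. Hence by induction on the construction S is a circle inside a single C(j), and a circle
-- contained in a circle is the whole circle, since its vertices already have all their
-- neighbours inside it and the big circle is connected.
module Submission where

open import Defs
open import Data.Bool using (Bool; true; false; _∧_; T; T?)
open import Data.Bool.Properties using (T-≡; ¬-not; ∧-zeroʳ; ∨-zeroʳ; ∨-identityʳ)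
open import Data.Empty using (⊥; ⊥-elim)
open import Data.List using (List; []; _∷_; [_]; length; filter; filterᵇ; _++_; map)
open import Data.List.Membership.Propositional using (_∈_; _∉_; find; lose)
open import Data.List.Membership.Propositional.Properties using (∈-filter⁺; ∈-filter⁻; ∈-++⁻)
open import Data.List.Properties
  using (filter-++; length-++; map-cong; filter-≐; filter-notAll; filter-some; filter-none)
open import Data.List.Relation.Binary.Subset.Propositional using (_⊆_)
open import Data.List.Relation.Unary.All as All using (All; []; _∷_)
open import Data.List.Relation.Unary.Any as Any using (Any; here; there; any?)
open import Data.List.Relation.Unary.Any.Properties using (any⁺; any⁻)
open import Data.List.Relation.Unary.AllPairs using ([]; _∷_)
open import Data.List.Relation.Unary.Unique.Propositional using (Unique)
open import Data.List.Relation.Unary.Unique.Propositional.Properties using (filter⁺)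
open import Data.Nat using (ℕ; zero; suc; _+_; _*_; _<_; _≤_; _≡ᵇ_; z≤n; s≤s)
open import Data.Nat.ListAction using (sum)
open import Data.Nat.Properties
  using (_≟_; ≡ᵇ⇒≡; ≡⇒≡ᵇ; +-assoc; +-identityʳ; +-cancelʳ-≡; *-suc; ≤-trans; ≤-refl;
         ≤-reflexive; ≤-antisym; <-irrefl; m≤n⇒m≤1+n; even≢odd; +-commutativeSemigroup)
open import Data.Nat.Tactic.RingSolver using (solve-∀)
open import Data.List.Membership.DecPropositional _≟_ using (_∈?_)
open import Algebra.Properties.CommutativeSemigroup +-commutativeSemigroup
  using (interchange; x∙yz≈y∙xz)
open import Data.Product using (Σ; ∃; ∃₂; _×_; _,_; proj₁; proj₂; map₂)
open import Data.Sum using (_⊎_; inj₁; inj₂)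
open import Function using (_∘_; Equivalence)
open import Relation.Binary.PropositionalEquality
  using (_≡_; _≢_; refl; sym; trans; cong; cong₂; subst; module ≡-Reasoning)
open import Relation.Nullary using (¬_; yes; no; ¬?)
open import Relation.Unary using (Pred; Decidable)
open import Relation.Unary.Properties using (∁?)

≡true⇒T : ∀ {b} → b ≡ true → T b
≡true⇒T = Equivalence.from T-≡

T⇒≡true : ∀ {b} → T b → b ≡ true
T⇒≡true = Equivalence.to T-≡

∧-true⁻ : ∀ {a b} → a ∧ b ≡ true → a ≡ true × b ≡ true
∧-true⁻ {true} b≡true = refl , b≡true

≡ᵇ-true⇒≡ : ∀ {m n} → (m ≡ᵇ n) ≡ true → m ≡ n
≡ᵇ-true⇒≡ = ≡ᵇ⇒≡ _ _ ∘ ≡true⇒T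

≢⇒≡ᵇ-false : ∀ {m n} → m ≢ n → (m ≡ᵇ n) ≡ false
≢⇒≡ᵇ-false m≢n = ¬-not (m≢n ∘ ≡ᵇ-true⇒≡)

∈ᵇ⇒∈ : ∀ {x xs} → x ∈ᵇ xs ≡ true → x ∈ xs
∈ᵇ⇒∈ {x} {xs} = Any.map (≡ᵇ⇒≡ _ _) ∘ any⁻ (x ≡ᵇ_) xs ∘ ≡true⇒T

∈⇒∈ᵇ : ∀ {x xs} → x ∈ xs → x ∈ᵇ xs ≡ true
∈⇒∈ᵇ {x} = T⇒≡true ∘ any⁺ (x ≡ᵇ_) ∘ Any.map (≡⇒≡ᵇ _ _)

length-≤-⊆ : ∀ {xs ys : List ℕ} → Unique xs → xs ⊆ ys → length xs ≤ length ys
length-≤-⊆ [] _ = z≤n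
length-≤-⊆ {x ∷ xs} {ys} (x∉xs ∷ uniq) xs⊆ys =
  ≤-trans (s≤s (length-≤-⊆ uniq xs⊆ys-x)) (filter-notAll (¬? ∘ (x ≟_)) ys x∈ys)
  where
  xs⊆ys-x : xs ⊆ filter (¬? ∘ (x ≟_)) ys
  xs⊆ys-x v∈xs = ∈-filter⁺ (¬? ∘ (x ≟_)) (xs⊆ys (there v∈xs)) (All.lookup x∉xs v∈xs)
  x∈ys : Any (λ v → ¬ ¬ x ≡ v) ys
  x∈ys = Any.map (λ x≡v x≢v → x≢v x≡v) (xs⊆ys (here refl))

count : (ℕ → Bool) → List ℕ → ℕ
count p xs = length (filterᵇ p xs)

∈-filterᵇ⁺ : ∀ {p : ℕ → Bool} {v xs} → v ∈ xs → p v ≡ true → v ∈ filterᵇ p xs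
∈-filterᵇ⁺ {p} v∈xs pv = ∈-filter⁺ (T? ∘ p) v∈xs (≡true⇒T pv)

∈-filterᵇ⁻ : ∀ {p : ℕ → Bool} {v xs} → v ∈ filterᵇ p xs → v ∈ xs × p v ≡ true
∈-filterᵇ⁻ {p} = map₂ T⇒≡true ∘ ∈-filter⁻ (T? ∘ p)

count-cong : ∀ {p q : ℕ → Bool} → (∀ v → p v ≡ q v) → ∀ xs → count p xs ≡ count q xs
count-cong {p} {q} p≗q =
  cong length ∘ filter-≐ (T? ∘ p) (T? ∘ q) ((λ {v} → subst T (p≗q v)) , (λ {v} → subst T (sym (p≗q v))))

count-++ : ∀ p xs ys → count p (xs ++ ys) ≡ count p xs + count p ys
count-++ p xs ys = trans (cong length (filter-++ (T? ∘ p) xs ys)) (length-++ (filterᵇ p xs))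

count-partition : ∀ {ℓ} {Q : Pred ℕ ℓ} (Q? : Decidable Q) p xs →
                  count p xs ≡ count p (filter Q? xs) + count p (filter (∁? Q?) xs)
count-partition Q? p [] = refl
count-partition Q? p (a ∷ xs) with Q? a
... | yes _ = begin
  count p (a ∷ xs)             ≡⟨ count-++ p [ a ] xs ⟩
  count p [ a ] + count p xs   ≡⟨ cong (count p [ a ] +_) (count-partition Q? p xs) ⟩
  count p [ a ] + (cQ + c∁Q)   ≡⟨ +-assoc (count p [ a ]) cQ c∁Q ⟨
  (count p [ a ] + cQ) + c∁Q   ≡⟨ cong (_+ c∁Q) (count-++ p [ a ] (filter Q? xs)) ⟨
  count p (a ∷ filter Q? xs) + c∁Q ∎
  where
  open ≡-Reasoning
  cQ = count p (filter Q? xs)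
  c∁Q = count p (filter (∁? Q?) xs)
... | no _ = begin
  count p (a ∷ xs)             ≡⟨ count-++ p [ a ] xs ⟩
  count p [ a ] + count p xs   ≡⟨ cong (count p [ a ] +_) (count-partition Q? p xs) ⟩
  count p [ a ] + (cQ + c∁Q)   ≡⟨ x∙yz≈y∙xz (count p [ a ]) cQ c∁Q ⟩
  cQ + (count p [ a ] + c∁Q)   ≡⟨ cong (cQ +_) (count-++ p [ a ] (filter (∁? Q?) xs)) ⟨
  cQ + count p (a ∷ filter (∁? Q?) xs) ∎
  where
  open ≡-Reasoning
  cQ = count p (filter Q? xs)
  c∁Q = count p (filter (∁? Q?) xs)

count-none : ∀ p xs → (∀ {v} → v ∈ xs → p v ≢ true) → count p xs ≡ 0
count-none p xs none = cong length (filter-none (T? ∘ p) (All.tabulate (λ v∈xs → none v∈xs ∘ T⇒≡true)))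

count-unique : ∀ p {y} xs → Unique xs → y ∈ xs → p y ≡ true →
               (∀ {v} → v ∈ xs → p v ≡ true → v ≡ y) → count p xs ≡ 1
count-unique p {y} xs uniq y∈xs py only-y =
  ≤-antisym at-most-one (filter-some (T? ∘ p) {xs} (lose y∈xs (≡true⇒T py)))
  where
  at-most-one : count p xs ≤ 1
  at-most-one = length-≤-⊆ {ys = [ y ]} (filter⁺ (T? ∘ p) uniq)
    (λ v∈filter → let v∈xs , pv = ∈-filterᵇ⁻ {p} v∈filter in here (only-y v∈xs pv))

count-singleton-cong : ∀ {p q : ℕ → Bool} {a b} → p a ≡ q b → count p [ a ] ≡ count q [ b ]
count-singleton-cong {p} {q} {a} {b} pa≡qb with p a | q b | pa≡qb
... | true  | .true  | refl = refl
... | false | .false | refl = refl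

sum-map-+ : ∀ (f g : ℕ → ℕ) xs → sum (map (λ u → f u + g u) xs) ≡ sum (map f xs) + sum (map g xs)
sum-map-+ f g [] = refl
sum-map-+ f g (a ∷ xs) =
  trans (cong (f a + g a +_) (sum-map-+ f g xs)) (interchange (f a) (g a) (sum (map f xs)) (sum (map g xs)))

sum-map-count-singleton : ∀ p xs → sum (map (λ u → count p [ u ]) xs) ≡ count p xs
sum-map-count-singleton p [] = refl
sum-map-count-singleton p (a ∷ xs) =
  trans (cong (count p [ a ] +_) (sum-map-count-singleton p xs)) (sym (count-++ p [ a ] xs))

handshake : ∀ (e : ℕ → ℕ → Bool) → (∀ u v → e u v ≡ e v u) → (∀ u → e u u ≡ false) →
            ∀ xs → ∃ λ m → sum (map (λ u → count (e u) xs) xs) ≡ 2 * m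
handshake e e-sym e-irrefl [] = 0 , refl
handshake e e-sym e-irrefl (a ∷ xs) with handshake e e-sym e-irrefl xs
... | m , sum≡2m = c + m , (begin
  count (e a) (a ∷ xs) + sum (map (λ u → count (e u) (a ∷ xs)) xs)
    ≡⟨ cong₂ _+_ (count-++ (e a) [ a ] xs) (cong sum (map-cong (λ u → count-++ (e u) [ a ] xs) xs)) ⟩
  (count (e a) [ a ] + c) + sum (map (λ u → count (e u) [ a ] + count (e u) xs) xs)
    ≡⟨ cong₂ _+_ (cong (_+ c) no-loop) (sum-map-+ _ _ xs) ⟩
  c + (sum (map (λ u → count (e u) [ a ]) xs) + sum (map (λ u → count (e u) xs) xs))
    ≡⟨ cong₂ (λ s t → c + (s + t)) edges-at-a sum≡2m ⟩
  c + (c + 2 * m)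
    ≡⟨ regroup c m ⟩
  2 * (c + m) ∎)
  where
  open ≡-Reasoning
  c = count (e a) xs
  no-loop : count (e a) [ a ] ≡ 0
  no-loop = count-singleton-cong {e a} {λ _ → false} {a} {a} (e-irrefl a)
  edges-at-a : sum (map (λ u → count (e u) [ a ]) xs) ≡ c
  edges-at-a = trans (cong sum (map-cong (λ u → count-singleton-cong {e u} {e a} {a} {u} (e-sym u a)) xs))
                     (sum-map-count-singleton (e a) xs)
  regroup : ∀ c m → c + (c + 2 * m) ≡ 2 * (c + m)
  regroup = solve-∀

sum-map-twos : ∀ (f : ℕ → ℕ) xs → (∀ {u} → u ∈ xs → f u ≡ 2) → sum (map f xs) ≡ 2 * length xs
sum-map-twos f [] _ = refl
sum-map-twos f (a ∷ xs) f≡2 =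
  trans (cong₂ _+_ (f≡2 (here refl)) (sum-map-twos f xs (f≡2 ∘ there))) (sym (*-suc 2 (length xs)))

sum-map-twos-but-one : ∀ (f : ℕ → ℕ) {x} xs → Unique xs → x ∈ xs → f x ≡ 1 →
                       (∀ {u} → u ∈ xs → u ≢ x → f u ≡ 2) → ∃ λ m → sum (map f xs) ≡ suc (2 * m)
sum-map-twos-but-one f {x} (a ∷ xs) (a∉xs ∷ uniq) x∈a∷xs fx≡1 f≡2 with a ≟ x | x∈a∷xs
... | yes refl | _ =
  length xs , cong₂ _+_ fx≡1 (sum-map-twos f xs (λ u∈xs → f≡2 (there u∈xs) (All.lookup a∉xs u∈xs ∘ sym)))
... | no a≢x | here x≡a = ⊥-elim (a≢x (sym x≡a))
... | no a≢x | there x∈xs with sum-map-twos-but-one f xs uniq x∈xs fx≡1 (f≡2 ∘ there)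
...   | m , sum≡2m+1 =
  suc m , trans (cong₂ _+_ (f≡2 (here refl) a≢x) sum≡2m+1) (cong suc (sym (*-suc 2 m)))

no-single-odd-degree : ∀ (e : ℕ → ℕ → Bool) → (∀ u v → e u v ≡ e v u) → (∀ u → e u u ≡ false) →
                       ∀ {x} xs → Unique xs → x ∈ xs → count (e x) xs ≡ 1 →
                       (∀ {u} → u ∈ xs → u ≢ x → count (e u) xs ≡ 2) → ⊥
no-single-odd-degree e e-sym e-irrefl xs uniq x∈xs deg-x deg-others
  with handshake e e-sym e-irrefl xs
     | sum-map-twos-but-one (λ u → count (e u) xs) xs uniq x∈xs deg-x deg-others
... | m , even | n , odd = even≢odd m n (trans (sym even) odd)

reach-leaves : ∀ {K : Graph} {V a b} → Reach K a b → a ∈ V → b ∉ V →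
               ∃₂ λ u z → u ∈ V × z ∉ V × adj K u z ≡ true
reach-leaves (here _) a∈V b∉V = ⊥-elim (b∉V a∈V)
reach-leaves {V = V} (step {z = z} _ e walk) a∈V b∉V with z ∈? V
... | yes z∈V = reach-leaves walk z∈V b∉V
... | no z∉V = _ , z , a∈V , z∉V , e

Reach-resp-adj : ∀ {V} {a b : ℕ → ℕ → Bool} → (∀ u v → a u v ≡ b u v) →
                 ∀ {s t} → Reach (mkGraph V a) s t → Reach (mkGraph V b) s t
Reach-resp-adj a≗b (here s∈V) = here s∈V
Reach-resp-adj a≗b (step s∈V e walk) = step s∈V (trans (sym (a≗b _ _)) e) (Reach-resp-adj a≗b walk)

IsCircle-resp-adj : ∀ {V} {a b : ℕ → ℕ → Bool} → (∀ u v → a u v ≡ b u v) →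
                    IsCircle (mkGraph V a) → IsCircle (mkGraph V b)
IsCircle-resp-adj {V} a≗b ((uniq , a-sym , a-irrefl , a-edges) , (nonempty , connected) , degree) =
  (uniq , (λ u v → trans (sym (a≗b u v)) (trans (a-sym u v) (a≗b v u)))
        , (λ u → trans (sym (a≗b u u)) (a-irrefl u))
        , (λ u v e → a-edges u v (trans (a≗b u v) e))) ,
  (nonempty , λ u v u∈V v∈V → Reach-resp-adj a≗b (connected u v u∈V v∈V)) ,
  (λ u u∈V → trans (sym (count-cong (a≗b u) V)) (degree u u∈V))

induced-adj-cong : ∀ {G G' : Graph} {S} → (∀ {u v} → u ∈ S → v ∈ S → adj G u v ≡ adj G' u v) →
                   ∀ u v → adj (induced G S) u v ≡ adj (induced G' S) u v
induced-adj-cong {G} {G'} {S} agree u v with u ∈ᵇ S in u∈ᵇS | v ∈ᵇ S in v∈ᵇS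
... | true  | true  = cong (_∧ true) (agree (∈ᵇ⇒∈ u∈ᵇS) (∈ᵇ⇒∈ v∈ᵇS))
... | true  | false = trans (∧-zeroʳ (adj G u v)) (sym (∧-zeroʳ (adj G' u v)))
... | false | _     = trans (∧-zeroʳ (adj G u v)) (sym (∧-zeroʳ (adj G' u v)))

IsCircle-induced-cong : ∀ {G G' : Graph} {S} → (∀ {u v} → u ∈ S → v ∈ S → adj G u v ≡ adj G' u v) →
                        IsCircle (induced G S) → IsCircle (induced G' S)
IsCircle-induced-cong {G} {G'} agree = IsCircle-resp-adj (induced-adj-cong {G} {G'} agree)

induced-adj⁻ : ∀ {K : Graph} {S u v} → adj (induced K S) u v ≡ true →
               adj K u v ≡ true × u ∈ S × v ∈ S
induced-adj⁻ e with ∧-true⁻ e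
... | e' , u∈ᵇS∧v∈ᵇS with ∧-true⁻ u∈ᵇS∧v∈ᵇS
...   | u∈ᵇS , v∈ᵇS = e' , ∈ᵇ⇒∈ u∈ᵇS , ∈ᵇ⇒∈ v∈ᵇS

induced-adj⁺ : ∀ {K : Graph} {S u v} → adj K u v ≡ true → u ∈ S → v ∈ S →
               adj (induced K S) u v ≡ true
induced-adj⁺ e u∈S v∈S rewrite e | ∈⇒∈ᵇ u∈S | ∈⇒∈ᵇ v∈S = refl

neighbour-∈-induced : ∀ {H : Graph} {S u z} → IsSimpleGraph H → Unique S → S ⊆ verts H → u ∈ S →
                      deg H u ≤ deg (induced H S) u → adj H u z ≡ true → z ∈ S
neighbour-∈-induced {H} {S} {u} {z} (_ , _ , _ , edges) uniq S⊆H u∈S deg≤ e with z ∈? S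
... | yes z∈S = z∈S
... | no z∉S = ⊥-elim (<-irrefl refl (≤-trans (length-≤-⊆ (z∉N ∷ uniqN) z∷N⊆NH) deg≤))
  where
  N = filterᵇ (adj (induced H S) u) S
  uniqN : Unique N
  uniqN = filter⁺ (T? ∘ adj (induced H S) u) uniq
  z∉N : All (z ≢_) N
  z∉N = All.tabulate (λ v∈N z≡v → z∉S (subst (_∈ S) (sym z≡v) (proj₁ (∈-filterᵇ⁻ v∈N))))
  z∷N⊆NH : z ∷ N ⊆ filterᵇ (adj H u) (verts H)
  z∷N⊆NH (here refl) = ∈-filterᵇ⁺ (proj₂ (edges u z e)) e
  z∷N⊆NH (there v∈N) with ∈-filterᵇ⁻ v∈N
  ... | v∈S , e' = ∈-filterᵇ⁺ (S⊆H v∈S) (proj₁ (induced-adj⁻ {H} {S} e'))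

circle-⊆-circle : ∀ {H : Graph} {S} → IsCircle H → S ⊆ verts H → IsCircle (induced H S) →
                  SameSet S (verts H)
circle-⊆-circle {H} {S} (simpleH , (_ , connectedH) , degH) S⊆H ((uniqS , _) , ((s , s∈S) , _) , degS) v =
  S⊆H , H⊆S
  where
  closed : ∀ {u z} → u ∈ S → adj H u z ≡ true → z ∈ S
  closed u∈S = neighbour-∈-induced simpleH uniqS S⊆H u∈S
                 (≤-reflexive (trans (degH _ (S⊆H u∈S)) (sym (degS _ u∈S))))
  H⊆S : v ∈ verts H → v ∈ S
  H⊆S v∈H with v ∈? S
  ... | yes v∈S = v∈S
  ... | no v∉S with reach-leaves (connectedH s v (S⊆H s∈S) v∈H) s∈S v∉S
  ...   | _ , _ , u∈S , z∉S , e = ⊥-elim (z∉S (closed u∈S e))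

⊆-++-avoidingʳ : ∀ {xs ys zs : List ℕ} → xs ⊆ ys ++ zs → ¬ Any (_∈ zs) xs → xs ⊆ ys
⊆-++-avoidingʳ {ys = ys} xs⊆ys++zs avoids v∈xs with ∈-++⁻ ys (xs⊆ys++zs v∈xs)
... | inj₁ v∈ys = v∈ys
... | inj₂ v∈zs = ⊥-elim (avoids (lose v∈xs v∈zs))

⊆-++-avoidingˡ : ∀ {xs ys zs : List ℕ} → xs ⊆ ys ++ zs → ¬ Any (_∈ ys) xs → xs ⊆ zs
⊆-++-avoidingˡ {ys = ys} xs⊆ys++zs avoids v∈xs with ∈-++⁻ ys (xs⊆ys++zs v∈xs)
... | inj₁ v∈ys = ⊥-elim (avoids (lose v∈xs v∈ys))
... | inj₂ v∈zs = v∈zs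

adj-outsideˡ : ∀ {K : Graph} {u} v → IsSimpleGraph K → u ∉ verts K → adj K u v ≡ false
adj-outsideˡ v (_ , _ , _ , edges) u∉K = ¬-not (u∉K ∘ proj₁ ∘ edges _ v)

adj-outsideʳ : ∀ {K : Graph} u {v} → IsSimpleGraph K → v ∉ verts K → adj K u v ≡ false
adj-outsideʳ u (_ , _ , _ , edges) v∉K = ¬-not (v∉K ∘ proj₂ ∘ edges u _)

module Bridge {G H : Graph} {x y : ℕ} (simpleG : IsSimpleGraph G) (simpleH : IsSimpleGraph H)
              (disjoint : Disjoint G H) (x∈G : x ∈ verts G) (y∈H : y ∈ verts H) where

  P : Graph
  P = plus G H x y

  separated : ∀ {u v} → u ∈ verts G → v ∈ verts H → u ≢ v
  separated u∈G v∈H refl = disjoint _ u∈G v∈H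

  plus-adjᴳ : ∀ {u v} → u ∈ verts G → v ∈ verts G → adj P u v ≡ adj G u v
  plus-adjᴳ {u} {v} u∈G v∈G
    rewrite adj-outsideˡ v simpleH (disjoint u u∈G)
          | ≢⇒≡ᵇ-false (separated v∈G y∈H) | ≢⇒≡ᵇ-false (separated u∈G y∈H)
          | ∧-zeroʳ (u ≡ᵇ x) = ∨-identityʳ (adj G u v)

  plus-adjᴴ : ∀ {u v} → u ∈ verts H → v ∈ verts H → adj P u v ≡ adj H u v
  plus-adjᴴ {u} {v} u∈H v∈H
    rewrite adj-outsideˡ v simpleG (λ u∈G → disjoint u u∈G u∈H)
          | ≢⇒≡ᵇ-false (separated x∈G u∈H ∘ sym) | ≢⇒≡ᵇ-false (separated x∈G v∈H ∘ sym)
          | ∧-zeroʳ (u ≡ᵇ y) = ∨-identityʳ (adj H u v)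

  plus-adj-bridge : adj P x y ≡ true
  plus-adj-bridge
    rewrite T⇒≡true (≡⇒≡ᵇ x x refl) | T⇒≡true (≡⇒≡ᵇ y y refl) | ∨-zeroʳ (adj H x y)
    = ∨-zeroʳ (adj G x y)

  plus-adj-leaving : ∀ {u z} → u ∈ verts G → z ∉ verts G → adj P u z ≡ true → u ≡ x × z ≡ y
  plus-adj-leaving {u} {z} u∈G z∉G e
    rewrite adj-outsideʳ u simpleG z∉G | adj-outsideˡ z simpleH (disjoint u u∈G)
          | ≢⇒≡ᵇ-false (separated u∈G y∈H) | ∨-identityʳ ((u ≡ᵇ x) ∧ (z ≡ᵇ y))
    with ∧-true⁻ e
  ... | u≡ᵇx , z≡ᵇy = ≡ᵇ-true⇒≡ u≡ᵇx , ≡ᵇ-true⇒≡ z≡ᵇy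

  circle-avoids-crossing : ∀ {S a b} → IsCircle (induced P S) →
                           a ∈ S → a ∈ verts G → b ∈ S → b ∈ verts H → ⊥
  circle-avoids-crossing {S} {a} {b} ((uniqS , e-sym , e-irrefl , _) , (_ , connected) , degS)
                         a∈S a∈G b∈S b∈H =
    no-single-odd-degree e e-sym e-irrefl A (filter⁺ (_∈? verts G) uniqS) x∈A deg-x deg-others
    where
    e = adj (induced P S)
    A = filter (_∈? verts G) S
    B = filter (∁? (_∈? verts G)) S

    ∈A⁻ : ∀ {u} → u ∈ A → u ∈ S × u ∈ verts G
    ∈A⁻ = ∈-filter⁻ (_∈? verts G) {xs = S}

    ∈B⁻ : ∀ {u} → u ∈ B → u ∈ S × u ∉ verts G
    ∈B⁻ = ∈-filter⁻ (∁? (_∈? verts G)) {xs = S}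

    bridge-∈ : x ∈ S × y ∈ S
    bridge-∈ with reach-leaves (connected a b a∈S b∈S) a∈G (λ b∈G → disjoint b b∈G b∈H)
    ... | _ , _ , u∈G , z∉G , e-uz with induced-adj⁻ {P} {S} e-uz
    ...   | adj-uz , u∈S , z∈S with plus-adj-leaving u∈G z∉G adj-uz
    ...     | refl , refl = u∈S , z∈S

    x∈A : x ∈ A
    x∈A = ∈-filter⁺ (_∈? verts G) (proj₁ bridge-∈) x∈G

    y∈B : y ∈ B
    y∈B = ∈-filter⁺ (∁? (_∈? verts G)) (proj₂ bridge-∈) (λ y∈G → disjoint y y∈G y∈H)

    A-to-B : ∀ {u v} → u ∈ A → v ∈ B → e u v ≡ true → u ≡ x × v ≡ y
    A-to-B u∈A v∈B e-uv =
      plus-adj-leaving (proj₂ (∈A⁻ u∈A)) (proj₂ (∈B⁻ v∈B)) (proj₁ (induced-adj⁻ {P} {S} e-uv))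

    degree-split : ∀ {u} → u ∈ A → count (e u) A + count (e u) B ≡ 2
    degree-split {u} u∈A =
      trans (sym (count-partition (_∈? verts G) (e u) S)) (degS u (proj₁ (∈A⁻ u∈A)))

    deg-x : count (e x) A ≡ 1
    deg-x = +-cancelʳ-≡ 1 _ 1 (trans (cong (count (e x) A +_) (sym toB)) (degree-split x∈A))
      where
      toB : count (e x) B ≡ 1
      toB = count-unique (e x) B (filter⁺ (∁? (_∈? verts G)) uniqS) y∈B
              (induced-adj⁺ {P} plus-adj-bridge (proj₁ bridge-∈) (proj₂ bridge-∈))
              (λ v∈B e-xv → proj₂ (A-to-B x∈A v∈B e-xv))

    deg-others : ∀ {u} → u ∈ A → u ≢ x → count (e u) A ≡ 2
    deg-others {u} u∈A u≢x =
      trans (sym (+-identityʳ _)) (trans (cong (count (e u) A +_) (sym noneToB)) (degree-split u∈A))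
      where
      noneToB : count (e u) B ≡ 0
      noneToB = count-none (e u) B (λ v∈B e-uv → u≢x (proj₁ (A-to-B u∈A v∈B e-uv)))

  circle-within-side : ∀ {S} → S ⊆ verts P → IsCircle (induced P S) →
                       (S ⊆ verts G × IsCircle (induced G S)) ⊎ (S ⊆ verts H × IsCircle (induced H S))
  circle-within-side {S} S⊆P circle with any? (_∈? verts G) S | any? (_∈? verts H) S
  ... | yes meetsG | yes meetsH with find meetsG | find meetsH
  ...   | a , a∈S , a∈G | b , b∈S , b∈H = ⊥-elim (circle-avoids-crossing circle a∈S a∈G b∈S b∈H)
  circle-within-side {S} S⊆P circle | _ | no avoidsH =
    inj₁ (S⊆G , IsCircle-induced-cong {P} {G} (λ u∈S v∈S → plus-adjᴳ (S⊆G u∈S) (S⊆G v∈S)) circle)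
    where
    S⊆G : S ⊆ verts G
    S⊆G = ⊆-++-avoidingʳ S⊆P avoidsH
  circle-within-side {S} S⊆P circle | no avoidsG | _ =
    inj₂ (S⊆H , IsCircle-induced-cong {P} {H} (λ u∈S v∈S → plus-adjᴴ (S⊆H u∈S) (S⊆H v∈S)) circle)
    where
    S⊆H : S ⊆ verts H
    S⊆H = ⊆-++-avoidingˡ S⊆P avoidsG

circle-in-plus : ∀ {G H x y S} → PlusOK G H x y → S ⊆ verts (plus G H x y) →
                 IsCircle (induced (plus G H x y) S) →
                 (S ⊆ verts G × IsCircle (induced G S)) ⊎ (S ⊆ verts H × IsCircle (induced H S))
circle-in-plus (simpleG , simpleH , disjoint , _ , _ , x∈G , _ , y∈H , _) =
  Bridge.circle-within-side simpleG simpleH disjoint x∈G y∈H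

ValidCT-pred : ∀ {m C att} → ValidCT (suc m) C att → ValidCT m C att
ValidCT-pred (circles , steps) = (λ i → circles i ∘ m≤n⇒m≤1+n) , (λ i → steps i ∘ m≤n⇒m≤1+n)

circle-in-stage : ∀ m {C att S} → ValidCT m C att → S ⊆ verts (ctStage C att m) →
                  IsCircle (induced (ctStage C att m) S) →
                  ∃ λ j → j < suc m × SameSet S (verts (C j))
circle-in-stage zero (circles , _) S⊆T circle =
  0 , s≤s z≤n , circle-⊆-circle (circles 0 z≤n) S⊆T circle
circle-in-stage (suc m) valid@(_ , steps) S⊆T circle with circle-in-plus (steps m ≤-refl) S⊆T circle
... | inj₁ (S⊆T' , circle') with circle-in-stage m (ValidCT-pred valid) S⊆T' circle'
...   | j , j<1+m , S≈Cj = j , m≤n⇒m≤1+n j<1+m , S≈Cj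
circle-in-stage (suc m) (circles , _) _ _ | inj₂ (S⊆C , circle') =
  suc m , ≤-refl , circle-⊆-circle (circles (suc m) ≤-refl) S⊆C circle'

lemma4p12 : (T : Graph) (k : ℕ) (C : ℕ → Graph) → IsCircleTreeBy T k C →
    (S : List ℕ) → Unique S → (∀ v → v ∈ S → v ∈ verts T) →
    IsCircle (induced T S) →
    Σ ℕ λ j → j < k × SameSet S (verts (C j))
lemma4p12 T zero C () S _ S⊆T circle
lemma4p12 T (suc m) C (att , valid , same-verts , same-adj) S _ S⊆T circle =
  circle-in-stage m valid (λ v∈S → subst (_ ∈_) same-verts (S⊆T _ v∈S))
    (IsCircle-induced-cong {T} {ctStage C att m} (λ {u} {v} _ _ → same-adj u v) circle)
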